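{- Let $H$ be any outcome of the construction below, and fix $\Delta>3$. Let $0\le i\le k$ and let $x,y\in V$ be such that $d_G(x,y)\le D_i$ and $d_H(x,p_i(x))\le \frac{2\Delta}{\Delta-3}D_{i-1}$, where $D_{ -1}=0$ and $D_j=W(x,y)\sum_{l=0}^{j}\Delta^l$ for $j\ge0$. Define $m=\max\{\Delta D_{i-1},d_G(x,y)\}$. Then at least one of the following holds: (1) $d_H(x,y)\le \left(3+\frac{8}{\Delta-3}\right)m$; (2) $d_H(x,p_{i+1}(x))\le \frac{2\Delta}{\Delta-3}D_i$.
   Context: Let $G=(V,E,w)$ be an undirected graph on $n$ vertices with non-negative edge weights, $d_G$ its shortest-path distance, and $k\ge1$ an integer; $\nu=1/(2^k-1)$. For $x,y\in V$, $W(x,y)=\max\{w(e):e\in P_{xy}\}$ where $P_{xy}$ is a shortest $x$–$y$ path in $G$. Let $A_0=V$, $A_k=\emptyset$, and for $0\le i\le k-2$ let $A_{i+1}$ be obtained by including each element of $A_i$ independently with probability $q_i=n^{ -2^i\nu}\cdot 2^{ -2^i-1}$. For $0\le i\le k-1$ and $v\in V$, the pivot $p_i(v)$ is the vertex of $A_i$ closest to $v$ in $d_G$ (ties broken lexicographically), so $p_0(v)=v$; pivots of level $\ge k$ do not exist, and a condition bounding the distance from $x$ to a nonexistent pivot is regarded as false. Let $d_G(u,A_{i+1})=\min_{a\in A_{i+1}}d_G(u,a)$ ($=\infty$ if $A_{i+1}=\emptyset$). For $u\in A_i\setminus A_{i+1}$, the bunch is $B(u)=\{v\in A_i: d_G(u,v)<d_G(u,A_{i+1})\}\cup\{p_j(u):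 i<j<k\}$. $H$ is the graph on $V$ with edges $\{u,v\}$ for all $u\in V$, $v\in B(u)$, of weight $d_G(u,v)$; $d_H$ is its shortest-path distance.
   Formalization: The edge weights of G and the parameter Δ are taken in the rationals. -}

module Defs where

open import Data.Nat as ℕ using (ℕ; zero; suc)
open import Data.Fin as Fin using (Fin)
open import Data.Fin.Subset using (Subset; _∈_; _∉_)
open import Data.Maybe using (Maybe; just; nothing)
open import Data.List using (List; []; _∷_)
open import Data.List.Relation.Unary.Unique.Propositional using (Unique)
open import Data.Product using (Σ; _×_; _,_)
open import Data.Sum using (_⊎_)
open import Data.Unit using (⊤)
open import Data.Empty using (⊥)
open import Relation.Nullary using (¬_)
open import Relation.Binary.PropositionalEquality using (_≡_; subst)
open import Data.Integer using (+_)
open import Data.Rational using (ℚ; 0ℚ; 1ℚ; _+_; _*_; _-_; _÷_; _⊔_; _≤_; _<_; -_; positive)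
open import Data.Rational.Properties using (pos⇒nonZero; +-monoˡ-<; +-inverseʳ)

ℚ[_] : ℕ → ℚ
ℚ[ m ] = (+ m) Data.Rational./ 1

pow : ℚ → ℕ → ℚ
pow q zero    = 1ℚ
pow q (suc j) = pow q j * q

geo : ℚ → ℕ → ℚ
geo Δ zero    = 1ℚ
geo Δ (suc j) = geo Δ j + pow Δ (suc j)

D : ℚ → ℚ → ℕ → ℚ
D W Δ j = W * geo Δ j

-- Dprev W Δ i = D_{i-1}, with D_{-1} = 0
Dprev : ℚ → ℚ → ℕ → ℚ
Dprev W Δ zero    = 0ℚ
Dprev W Δ (suc j) = D W Δ j

Δ-3>0 : (Δ : ℚ) → ℚ[ 3 ] < Δ → 0ℚ < Δ - ℚ[ 3 ]
Δ-3>0 Δ h = subst (_< Δ - ℚ[ 3 ]) (+-inverseʳ ℚ[ 3 ]) (+-monoˡ-< (- ℚ[ 3 ]) h)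

_÷[Δ-3]_ : ℚ → Σ ℚ (λ Δ → ℚ[ 3 ] < Δ) → ℚ
c ÷[Δ-3] (Δ , h) =
  let instance _ = positive (Δ-3>0 Δ h) in
  (c ÷ (Δ - ℚ[ 3 ])) {{pos⇒nonZero (Δ - ℚ[ 3 ])}}

data ℚ∞ : Set where
  fin : ℚ → ℚ∞
  ∞   : ℚ∞

_≤∞_ : ℚ∞ → ℚ∞ → Set
fin a ≤∞ fin b = a ≤ b
fin a ≤∞ ∞     = ⊤
∞     ≤∞ fin b = ⊥
∞     ≤∞ ∞     = ⊤

_<∞_ : ℚ∞ → ℚ∞ → Set
fin a <∞ fin b = a < b
fin a <∞ ∞     = ⊤
∞     <∞ _     = ⊥

-- Undirected simple graphs with non-negative rational edge weights on Fin n.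
-- weight x y ≡ just c  means {x,y} is an edge of weight c.

record Graph (n : ℕ) : Set where
  field
    weight  : Fin n → Fin n → Maybe ℚ
    sym     : ∀ x y → weight x y ≡ weight y x
    noLoop  : ∀ x → weight x x ≡ nothing
    nonneg  : ∀ x y c → weight x y ≡ just c → 0ℚ ≤ c

EdgeRel : ℕ → Set₁
EdgeRel n = Fin n → Fin n → ℚ → Set

GEdge : ∀ {n} → Graph n → EdgeRel n
GEdge G x y c = Graph.weight G x y ≡ just c

data Walk {n} (E : EdgeRel n) : Fin n → Fin n → Set where
  []   : ∀ {x} → Walk E x x
  step : ∀ {x y z} (c : ℚ) → E x y c → Walk E y z → Walk E x z

len : ∀ {n} {E : EdgeRel n} {x y} → Walk E x y → ℚ
len []             = 0ℚ
len (step c _ p)   = c + len p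

maxW : ∀ {n} {E : EdgeRel n} {x y} → Walk E x y → ℚ
maxW []            = 0ℚ
maxW (step c _ p)  = c ⊔ maxW p

vertices : ∀ {n} {E : EdgeRel n} {x y} → Walk E x y → List (Fin n)
vertices ([] {x})          = x ∷ []
vertices (step {x} _ _ p)  = x ∷ vertices p

IsPath : ∀ {n} {E : EdgeRel n} {x y} → Walk E x y → Set
IsPath p = Unique (vertices p)

IsDist : ∀ {n} → EdgeRel n → Fin n → Fin n → ℚ∞ → Set
IsDist E x y ∞       = ¬ Walk E x y
IsDist E x y (fin q) = Σ (Walk E x y) (λ p → len p ≡ q) × (∀ (p : Walk E x y) → q ≤ len p)

IsDistFn : ∀ {n} → EdgeRel n → (Fin n → Fin n → ℚ∞) → Set
IsDistFn E d = ∀ x y → IsDist E x y (d x y)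

-- A is an outcome of the sampling: A 0 = V, A k = ∅, A (j+1) ⊆ A j
IsHierarchy : ∀ {n} → ℕ → (ℕ → Subset n) → Set
IsHierarchy {n} k A =
  (∀ v → v ∈ A 0) × (∀ v → v ∉ A k) × (∀ j v → v ∈ A (suc j) → v ∈ A j)

IsPivotFn : ∀ {n} → (ℕ → Subset n) → (Fin n → Fin n → ℚ∞) →
            (ℕ → Fin n → Maybe (Fin n)) → Set
IsPivotFn {n} A dG piv = ∀ i v →
  (piv i v ≡ nothing → ∀ a → a ∉ A i) ×
  (∀ p → piv i v ≡ just p →
     p ∈ A i ×
     (∀ a → a ∈ A i → (dG v p <∞ dG v a) ⊎ ((dG v p ≡ dG v a) × (p Fin.≤ a))))

InBunch : ∀ {n} → ℕ → (ℕ → Subset n) → (Fin n → Fin n → ℚ∞) →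
          (ℕ → Fin n → Maybe (Fin n)) → Fin n → Fin n → Set
InBunch k A dG piv u v =
  Σ ℕ λ i → (u ∈ A i) × (u ∉ A (suc i)) ×
    ( ( v ∈ A i × (dG u v <∞ ∞) × (∀ a → a ∈ A (suc i) → dG u v <∞ dG u a) )
    ⊎ ( Σ ℕ λ j → (i ℕ.< j) × (j ℕ.< k) × (piv j u ≡ just v) ) )

-- edges of H: {u,v} with v ∈ B(u) (or u ∈ B(v)), of weight dG u v
-- (pairs at infinite dG-distance contribute no usable edge)
HEdge : ∀ {n} → ℕ → (ℕ → Subset n) → (Fin n → Fin n → ℚ∞) →
        (ℕ → Fin n → Maybe (Fin n)) → EdgeRel n
HEdge k A dG piv u v c =
  (InBunch k A dG piv u v ⊎ InBunch k A dG piv v u) × (dG u v ≡ fin c)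

{-# OPTIONS --safe #-}
module Submission where

-- Let u = p_i(x), e = dH(x,u), d = dG(x,y) and R = 2Δ/(Δ-3)·D_i. If dG(x,p_{i+1}(x)) ≤ R, then
-- p_{i+1}(x) is joined to x in H by a pivot edge (or, when x ∈ A_{i+1}, by zero-length bunch
-- edges), which is (2). Otherwise the R-ball around x misses A_{i+1}. Since v = p_i(y) has
-- dG(u,v) ≤ 2(e+d) and e + 2(e+d) ≤ R, the 2(e+d)-ball around u misses A_{i+1} as well, so
-- u ∉ A_{i+1} and v ∈ B(u). The H-path x → u → v → y then has length at most 4e + 3d, and
-- e ≤ 2Δ/(Δ-3)·D_{i-1} turns this into (3 + 8/(Δ-3))·m.

open import Defs
open import Data.Nat using (ℕ; _≥_)
open import Data.Fin using (Fin)
open import Data.Fin.Subset using (Subset)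
open import Data.Maybe using (Maybe; just)
open import Data.Product using (Σ; _×_; _,_)
open import Data.Sum using (_⊎_)
open import Relation.Binary.PropositionalEquality using (_≡_)
open import Data.Rational using (ℚ; _+_; _*_; _⊔_; _<_; _≤_)

open import Data.Nat as ℕ using (zero; suc; _≤′_; ≤′-refl; ≤′-step)
import Data.Nat.Properties as ℕP
import Data.Fin as Fin
import Data.Fin.Properties as FinP
open import Data.Fin.Subset using (_∈_; _∉_)
open import Data.Fin.Subset.Properties using (_∈?_)
open import Data.Maybe using (nothing)
open import Data.Product using (∃; proj₁; proj₂)
open import Data.Sum using (inj₁; inj₂; [_,_]′)
open import Function using (_∘_)
open import Data.Unit using (tt)
open import Data.Empty using (⊥-elim)
open import Relation.Nullary using (¬_; Dec; yes; no)
open import Relation.Nullary.Decidable using (_×-dec_)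
open import Relation.Unary using (Decidable)
open import Relation.Binary.PropositionalEquality using (refl; sym; trans; cong; cong₂; subst; module ≡-Reasoning)
open import Data.Rational using (0ℚ; 1ℚ; _-_; 1/_; _≤?_; NonNegative; Positive; nonNegative; positive)
import Data.Rational.Properties as ℚP
open import Tactic.RingSolver using (solve-∀)
open import Tactic.RingSolver.Core.AlmostCommutativeRing using (AlmostCommutativeRing; fromCommutativeRing)

≤∞-reflexive : ∀ {r s} → r ≡ s → r ≤∞ s
≤∞-reflexive {fin a} refl = ℚP.≤-refl
≤∞-reflexive {∞}     refl = tt

≤∞-trans : ∀ {r s t} → r ≤∞ s → s ≤∞ t → r ≤∞ t
≤∞-trans {fin a} {fin b} {fin c} r≤s s≤t = ℚP.≤-trans r≤s s≤t
≤∞-trans {fin a} {s}     {∞}     _   _   = tt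
≤∞-trans {fin a} {∞}     {fin c} _   ()
≤∞-trans {∞}     {fin b} {t}     ()  _
≤∞-trans {∞}     {∞}     {fin c} _   ()
≤∞-trans {∞}     {∞}     {∞}     _   _   = tt

<∞-≤∞-trans : ∀ {r s t} → r <∞ s → s ≤∞ t → r <∞ t
<∞-≤∞-trans {fin a} {fin b} {fin c} r<s s≤t = ℚP.<-≤-trans r<s s≤t
<∞-≤∞-trans {fin a} {s}     {∞}     _   _   = tt
<∞-≤∞-trans {fin a} {∞}     {fin c} _   ()

≤∞-<∞-trans : ∀ {r s t} → r ≤∞ s → s <∞ t → r <∞ t
≤∞-<∞-trans {fin a} {fin b} {fin c} r≤s s<t = ℚP.≤-<-trans r≤s s<t
≤∞-<∞-trans {fin a} {s}     {∞}     _   _   = tt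
≤∞-<∞-trans {fin a} {∞}     {fin c} _   ()
≤∞-<∞-trans {∞}     {fin b}         ()  _
≤∞-<∞-trans {∞}     {∞}             _   ()

<∞⇒≤∞ : ∀ {r s} → r <∞ s → r ≤∞ s
<∞⇒≤∞ {fin a} {fin b} r<s = ℚP.<⇒≤ r<s
<∞⇒≤∞ {fin a} {∞}     _   = tt

≤∞⇒≯∞ : ∀ {r q} → r ≤∞ fin q → ¬ (fin q <∞ r)
≤∞⇒≯∞ r≤q q<r = ℚP.<-irrefl refl (<∞-≤∞-trans q<r r≤q)

≤∞-fin⇒fin : ∀ {r q} → r ≤∞ fin q → ∃ λ c → r ≡ fin c
≤∞-fin⇒fin {fin c} _ = c , refl

_≤∞-fin?_ : ∀ r q → Dec (r ≤∞ fin q)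
fin a ≤∞-fin? q = a ≤? q
∞     ≤∞-fin? q = no λ ()

≰∞⇒>∞ : ∀ {r q} → ¬ (r ≤∞ fin q) → fin q <∞ r
≰∞⇒>∞ {fin a} a≰q = ℚP.≰⇒> a≰q
≰∞⇒>∞ {∞}     _   = tt

transition-below : ∀ {P : ℕ → Set} → Decidable P → P 0 → ∀ m → ¬ P m →
                   ∃ λ j → j ℕ.< m × P j × ¬ P (suc j)
transition-below P? P0 zero ¬Pm = ⊥-elim (¬Pm P0)
transition-below P? P0 (suc m) ¬Pm+1 with P? m
... | yes Pm = m , ℕP.n<1+n m , Pm , ¬Pm+1
... | no ¬Pm with transition-below P? P0 m ¬Pm
...   | j , j<m , Pj , ¬Pj+1 = j , ℕP.m<n⇒m<1+n j<m , Pj , ¬Pj+1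

module _ {n : ℕ} {E : EdgeRel n} where

  infixr 5 _++ʷ_
  _++ʷ_ : ∀ {x y z} → Walk E x y → Walk E y z → Walk E x z
  []           ++ʷ q = q
  step c e p   ++ʷ q = step c e (p ++ʷ q)

  len-++ʷ : ∀ {x y z} (p : Walk E x y) (q : Walk E y z) → len (p ++ʷ q) ≡ len p + len q
  len-++ʷ []           q = sym (ℚP.+-identityˡ (len q))
  len-++ʷ (step c e p) q = trans (cong (c +_) (len-++ʷ p q)) (sym (ℚP.+-assoc c (len p) (len q)))

  len-nonNeg : (∀ {x y c} → E x y c → 0ℚ ≤ c) → ∀ {x y} (w : Walk E x y) → 0ℚ ≤ len w
  len-nonNeg E≥0 []           = ℚP.≤-refl
  len-nonNeg E≥0 (step c e w) = ℚP.+-mono-≤ (E≥0 e) (len-nonNeg E≥0 w)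

  maxW-nonNeg : ∀ {x y} (w : Walk E x y) → 0ℚ ≤ maxW w
  maxW-nonNeg []           = ℚP.≤-refl
  maxW-nonNeg (step c e w) = ℚP.≤-trans (maxW-nonNeg w) (ℚP.p≤q⊔p c (maxW w))

  module _ (E-sym : ∀ {x y c} → E x y c → E y x c) where

    reverseʷ : ∀ {x y} → Walk E x y → Walk E y x
    reverseʷ []           = []
    reverseʷ (step c e p) = reverseʷ p ++ʷ step c (E-sym e) []

    len-reverseʷ : ∀ {x y} (p : Walk E x y) → len (reverseʷ p) ≡ len p
    len-reverseʷ []           = refl
    len-reverseʷ (step c e p) = begin
      len (reverseʷ p ++ʷ step c (E-sym e) []) ≡⟨ len-++ʷ (reverseʷ p) _ ⟩
      len (reverseʷ p) + (c + 0ℚ)              ≡⟨ cong₂ _+_ (len-reverseʷ p) (ℚP.+-identityʳ c) ⟩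
      len p + c                                ≡⟨ ℚP.+-comm (len p) c ⟩
      c + len p                                ∎
      where open ≡-Reasoning

module Distance {n : ℕ} {E : EdgeRel n} {d : Fin n → Fin n → ℚ∞} (isD : IsDistFn E d) where

  dist≤len : ∀ {x y} (w : Walk E x y) → d x y ≤∞ fin (len w)
  dist≤len {x} {y} w with d x y | isD x y
  ... | fin q | _ , minimal = minimal w
  ... | ∞     | noWalk      = noWalk w

  dist-witness : ∀ {x y s} → d x y ≤∞ fin s → Σ (Walk E x y) λ w → len w ≤ s
  dist-witness {x} {y} xy≤s with d x y | isD x y
  ... | fin q | (w , refl) , _ = w , xy≤s

  dist-triangle : ∀ {x y z r s} → d x y ≤∞ fin r → d y z ≤∞ fin s → d x z ≤∞ fin (r + s)
  dist-triangle xy≤r yz≤s with dist-witness xy≤r | dist-witness yz≤s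
  ... | p , p≤r | q , q≤s = ≤∞-trans (dist≤len (p ++ʷ q))
    (subst (_≤ _) (sym (len-++ʷ p q)) (ℚP.+-mono-≤ p≤r q≤s))

  dist-refl : ∀ {x} → d x x ≤∞ fin 0ℚ
  dist-refl = dist≤len []

  dist-triangle₀ : ∀ {x y z} → d x y ≤∞ fin 0ℚ → d y z ≤∞ fin 0ℚ → d x z ≤∞ fin 0ℚ
  dist-triangle₀ xy≤0 yz≤0 = ≤∞-trans (dist-triangle xy≤0 yz≤0) (ℚP.≤-reflexive (ℚP.+-identityʳ 0ℚ))

  dist-edge : ∀ {x y c} → E x y c → d x y ≤∞ fin c
  dist-edge {c = c} e = ≤∞-trans (dist≤len (step c e [])) (ℚP.≤-reflexive (ℚP.+-identityʳ c))

  dist-nonNeg : (∀ {x y c} → E x y c → 0ℚ ≤ c) → ∀ {x y} → fin 0ℚ ≤∞ d x y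
  dist-nonNeg E≥0 {x} {y} with d x y | isD x y
  ... | fin q | (w , refl) , _ = len-nonNeg E≥0 w
  ... | ∞     | _              = tt

  dist-sym : (∀ {x y c} → E x y c → E y x c) → ∀ x y → d x y ≡ d y x
  dist-sym E-sym x y with d x y | isD x y | d y x | isD y x
  ... | fin _ | (p , refl) , minp | fin _ | (q , refl) , minq =
    cong fin (ℚP.≤-antisym (subst (_ ≤_) (len-reverseʷ E-sym q) (minp (reverseʷ E-sym q)))
                           (subst (_ ≤_) (len-reverseʷ E-sym p) (minq (reverseʷ E-sym p))))
  ... | fin _ | (p , _) , _ | ∞ | noWalk = ⊥-elim (noWalk (reverseʷ E-sym p))
  ... | ∞ | noWalk | fin _ | (q , _) , _ = ⊥-elim (noWalk (reverseʷ E-sym q))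
  ... | ∞ | _      | ∞     | _           = refl

module Hierarchy {n k : ℕ} {A : ℕ → Subset n} (hier : IsHierarchy k A) where

  ∈A-antitone : ∀ {v j l} → j ≤′ l → v ∈ A l → v ∈ A j
  ∈A-antitone ≤′-refl        v∈ = v∈
  ∈A-antitone (≤′-step j≤l) v∈ = ∈A-antitone j≤l (proj₂ (proj₂ hier) _ _ v∈)

  ∈A⇒<k : ∀ {v l} → v ∈ A l → l ℕ.< k
  ∈A⇒<k {v} {l} v∈ = ℕP.≰⇒> λ k≤l → proj₁ (proj₂ hier) v (∈A-antitone (ℕP.≤⇒≤′ k≤l) v∈)

  level-below : ∀ {v m} → v ∉ A m → ∃ λ j → j ℕ.< m × v ∈ A j × v ∉ A (suc j)
  level-below {v} {m} = transition-below (λ l → v ∈? A l) (proj₁ hier v) m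

module Emulator {n k : ℕ} (G : Graph n) (A : ℕ → Subset n) (hier : IsHierarchy k A)
  (dG : Fin n → Fin n → ℚ∞) (isDG : IsDistFn (GEdge G) dG)
  (piv : ℕ → Fin n → Maybe (Fin n)) (isP : IsPivotFn A dG piv)
  (dH : Fin n → Fin n → ℚ∞) (isDH : IsDistFn (HEdge k A dG piv) dH) where

  open Hierarchy hier
  module G = Distance isDG
  module H = Distance isDH

  Bunch : Fin n → Fin n → Set
  Bunch = InBunch k A dG piv

  dG-sym : ∀ x y → dG x y ≡ dG y x
  dG-sym = G.dist-sym λ {x} {y} e → trans (Graph.sym G y x) e

  dG-nonNeg : ∀ {x y} → fin 0ℚ ≤∞ dG x y
  dG-nonNeg = G.dist-nonNeg λ {x} {y} {c} → Graph.nonneg G x y c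

  dG-flip : ∀ {x y s} → dG x y ≤∞ fin s → dG y x ≤∞ fin s
  dG-flip {x} {y} = subst (_≤∞ fin _) (dG-sym x y)

  dH-sym : ∀ x y → dH x y ≡ dH y x
  dH-sym = H.dist-sym λ {x} {y} → λ where
    (inj₁ xy , xy≡c) → inj₂ xy , trans (dG-sym y x) xy≡c
    (inj₂ yx , xy≡c) → inj₁ yx , trans (dG-sym y x) xy≡c

  dH-flip : ∀ {x y s} → dH x y ≤∞ fin s → dH y x ≤∞ fin s
  dH-flip {x} {y} = subst (_≤∞ fin _) (dH-sym x y)

  dG≤len-H : ∀ {x y} (w : Walk (HEdge k A dG piv) x y) → dG x y ≤∞ fin (len w)
  dG≤len-H []                     = G.dist-refl
  dG≤len-H (step c (_ , xy≡c) w) = G.dist-triangle (≤∞-reflexive xy≡c) (dG≤len-H w)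

  dG≤dH : ∀ {x y s} → dH x y ≤∞ fin s → dG x y ≤∞ fin s
  dG≤dH xy≤s with H.dist-witness xy≤s
  ... | w , w≤s = ≤∞-trans (dG≤len-H w) w≤s

  bunch-edge : ∀ {u v s} → Bunch u v ⊎ Bunch v u → dG u v ≤∞ fin s → dH u v ≤∞ fin s
  bunch-edge uv uv≤s with ≤∞-fin⇒fin uv≤s
  ... | c , uv≡c = ≤∞-trans (H.dist-edge (uv , uv≡c)) (subst (_≤∞ fin _) uv≡c uv≤s)

  pivot∈A : ∀ {l x p} → piv l x ≡ just p → p ∈ A l
  pivot∈A {l} {x} eq = proj₁ (proj₂ (isP l x) _ eq)

  pivot-closest : ∀ {l x p a} → piv l x ≡ just p → a ∈ A l → dG x p ≤∞ dG x a
  pivot-closest {l} {x} {p} {a} eq a∈ with proj₂ (proj₂ (isP l x) p eq) a a∈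
  ... | inj₁ xp<xa           = <∞⇒≤∞ xp<xa
  ... | inj₂ (xp≡xa , _)     = ≤∞-reflexive xp≡xa

  pivot-exists : ∀ {l x a} → a ∈ A l → ∃ λ p → piv l x ≡ just p
  pivot-exists {l} {x} {a} a∈ with piv l x in eq
  ... | just p  = p , refl
  ... | nothing = ⊥-elim (proj₁ (isP l x) eq a a∈)

  pivot-least-among-coincident : ∀ {l x p a} → piv l x ≡ just p → a ∈ A l → dG x a ≤∞ fin 0ℚ → p Fin.≤ a
  pivot-least-among-coincident {l} {x} {p} {a} eq a∈ xa≤0 with proj₂ (proj₂ (isP l x) p eq) a a∈
  ... | inj₁ xp<xa      = ⊥-elim (≤∞⇒≯∞ xa≤0 (≤∞-<∞-trans dG-nonNeg xp<xa))
  ... | inj₂ (_ , p≤a)  = p≤a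

  pivot-in-bunch : ∀ {j l x p} → x ∈ A j → x ∉ A (suc j) → j ℕ.< l → piv l x ≡ just p → Bunch x p
  pivot-in-bunch {j} {l} x∈ x∉ j<l eq = j , x∈ , x∉ , inj₂ (l , j<l , ∈A⇒<k (pivot∈A eq) , eq)

  ball-in-bunch : ∀ {i u v w} → u ∈ A i → u ∉ A (suc i) → v ∈ A i → dG u v ≤∞ fin w →
                  (∀ a → a ∈ A (suc i) → fin w <∞ dG u a) → Bunch u v
  ball-in-bunch {i} u∈ u∉ v∈ uv≤w beyond =
    i , u∈ , u∉ , inj₁ (v∈ , ≤∞-<∞-trans uv≤w tt , λ a a∈ → ≤∞-<∞-trans uv≤w (beyond a a∈))

  -- Zero-weight edges allow p_l(x) ≠ x although x ∈ A_l. The vertices at dG-distance 0 from a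
  -- all have the same pivot at the highest level L that this cluster meets, and each is joined
  -- to it by a bunch edge of length 0 (a pivot edge below level L, a ball edge at level L).
  module Coincident (a : Fin n) where

    MeetsLevel : ℕ → Set
    MeetsLevel l = ∃ λ z → dG a z ≤∞ fin 0ℚ × z ∈ A l

    top-level : ∃ λ L → L ℕ.< k × MeetsLevel L × ¬ MeetsLevel (suc L)
    top-level = transition-below (λ l → FinP.any? λ z → (dG a z ≤∞-fin? 0ℚ) ×-dec (z ∈? A l))
      (a , G.dist-refl , proj₁ hier a) k (λ (z , _ , z∈) → proj₁ (proj₂ hier) z z∈)

    representative : ∀ {L b} → MeetsLevel L → ¬ MeetsLevel (suc L) → dG a b ≤∞ fin 0ℚ →
                     ∃ λ c → piv L b ≡ just c × dG b c ≤∞ fin 0ℚ × dH b c ≤∞ fin 0ℚ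
    representative {L} {b} (z , az≤0 , z∈) ¬top ab≤0 with pivot-exists {x = b} z∈
    ... | c , eq = c , eq , bc≤0 , bunch-edge (inj₁ b→c) bc≤0
      where
      bc≤0 : dG b c ≤∞ fin 0ℚ
      bc≤0 = ≤∞-trans (pivot-closest eq z∈) (G.dist-triangle₀ (dG-flip ab≤0) az≤0)

      b∉ : b ∉ A (suc L)
      b∉ b∈ = ¬top (b , ab≤0 , b∈)

      beyond : ∀ a′ → a′ ∈ A (suc L) → fin 0ℚ <∞ dG b a′
      beyond a′ a′∈ with dG b a′ ≤∞-fin? 0ℚ
      ... | yes ba′≤0 = ⊥-elim (¬top (a′ , G.dist-triangle₀ ab≤0 ba′≤0 , a′∈))
      ... | no ba′≰0  = ≰∞⇒>∞ ba′≰0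

      b→c : Bunch b c
      b→c with level-below b∉
      ... | j , j<L+1 , b∈j , b∉j+1 with ℕP.m<1+n⇒m<n∨m≡n j<L+1
      ... | inj₁ j<L  = pivot-in-bunch b∈j b∉j+1 j<L eq
      ... | inj₂ refl = ball-in-bunch b∈j b∉j+1 (pivot∈A eq) bc≤0 beyond

  coincident⇒dH≤0 : ∀ {a b} → dG a b ≤∞ fin 0ℚ → dH a b ≤∞ fin 0ℚ
  coincident⇒dH≤0 {a} {b} ab≤0 with Coincident.top-level a
  ... | L , _ , meets , ¬top
      with Coincident.representative a meets ¬top G.dist-refl
         | Coincident.representative a meets ¬top ab≤0
  ... | c , a→c , ac≤0 , ac≤0ᴴ | c′ , b→c′ , bc′≤0 , bc′≤0ᴴ
      with FinP.≤-antisym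
             (pivot-least-among-coincident a→c (pivot∈A b→c′) (G.dist-triangle₀ ab≤0 bc′≤0))
             (pivot-least-among-coincident b→c′ (pivot∈A a→c) (G.dist-triangle₀ (dG-flip ab≤0) ac≤0))
  ... | refl = H.dist-triangle₀ ac≤0ᴴ (dH-flip bc′≤0ᴴ)

  dH-pivot : ∀ {l x p s} → piv l x ≡ just p → dG x p ≤∞ fin s → dH x p ≤∞ fin s
  dH-pivot {l} {x} {p} eq xp≤s with x ∈? A l
  ... | yes x∈ = ≤∞-trans (coincident⇒dH≤0 xp≤0) (≤∞-trans dG-nonNeg xp≤s)
    where
    xp≤0 : dG x p ≤∞ fin 0ℚ
    xp≤0 = ≤∞-trans (pivot-closest eq x∈) G.dist-refl
  ... | no x∉ with level-below x∉
  ...   | j , j<l , x∈j , x∉j+1 = bunch-edge (inj₁ (pivot-in-bunch x∈j x∉j+1 j<l eq)) xp≤s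

  pivot-near-or-ball-avoids : ∀ l x R → (∃ λ p → piv l x ≡ just p × dH x p ≤∞ fin R)
                                       ⊎ (∀ a → a ∈ A l → fin R <∞ dG x a)
  pivot-near-or-ball-avoids l x R with piv l x in eq
  ... | nothing = inj₂ λ a a∈ → ⊥-elim (proj₁ (isP l x) eq a a∈)
  ... | just p with dG x p ≤∞-fin? R
  ...   | yes xp≤R = inj₁ (p , refl , dH-pivot eq xp≤R)
  ...   | no xp≰R  = inj₂ λ a a∈ → <∞-≤∞-trans (≰∞⇒>∞ xp≰R) (pivot-closest eq a∈)

  detour-via-pivots : ∀ {i x y u e d R} → piv i x ≡ just u → dH x u ≤∞ fin e → dG x y ≤∞ fin d →
                      e + ((e + d) + (e + d)) ≤ R → (∀ a → a ∈ A (suc i) → fin R <∞ dG x a) →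
                      dH x y ≤∞ fin (e + ((e + d) + (e + d)) + (e + d))
  detour-via-pivots {i} {x} {y} {u} {e} {d} {R} x→u xu≤e xy≤d detour≤R far
    with pivot-exists {x = y} (pivot∈A x→u)
  ... | v , y→v = H.dist-triangle (H.dist-triangle xu≤e uv≤w) (dH-flip yv≤e+d)
    where
    w : ℚ
    w = (e + d) + (e + d)

    xu≤eᴳ : dG x u ≤∞ fin e
    xu≤eᴳ = dG≤dH xu≤e

    yv≤e+dᴳ : dG y v ≤∞ fin (e + d)
    yv≤e+dᴳ = ≤∞-trans (pivot-closest y→v (pivot∈A x→u))
      (≤∞-trans (G.dist-triangle (dG-flip xy≤d) xu≤eᴳ) (ℚP.≤-reflexive (ℚP.+-comm d e)))

    yv≤e+d : dH y v ≤∞ fin (e + d)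
    yv≤e+d = dH-pivot y→v yv≤e+dᴳ

    uv≤wᴳ : dG u v ≤∞ fin w
    uv≤wᴳ = G.dist-triangle (G.dist-triangle (dG-flip xu≤eᴳ) xy≤d) yv≤e+dᴳ

    0≤w : 0ℚ ≤ w
    0≤w = ≤∞-trans dG-nonNeg uv≤wᴳ

    e≤R : e ≤ R
    e≤R = begin
      e      ≡⟨ ℚP.+-identityʳ e ⟨
      e + 0ℚ ≤⟨ ℚP.+-monoʳ-≤ e 0≤w ⟩
      e + w  ≤⟨ detour≤R ⟩
      R      ∎
      where open ℚP.≤-Reasoning

    u∉ : u ∉ A (suc i)
    u∉ u∈ = ≤∞⇒≯∞ (≤∞-trans xu≤eᴳ e≤R) (far u u∈)

    beyond : ∀ a → a ∈ A (suc i) → fin w <∞ dG u a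
    beyond a a∈ with dG u a ≤∞-fin? w
    ... | yes ua≤w = ⊥-elim (≤∞⇒≯∞ (≤∞-trans (G.dist-triangle xu≤eᴳ ua≤w) detour≤R) (far a a∈))
    ... | no ua≰w  = ≰∞⇒>∞ ua≰w

    uv≤w : dH u v ≤∞ fin w
    uv≤w = bunch-edge (inj₁ (ball-in-bunch (pivot∈A x→u) u∉ (pivot∈A y→v) uv≤wᴳ beyond)) uv≤wᴳ

ℚ-ring : AlmostCommutativeRing _ _
ℚ-ring = fromCommutativeRing ℚP.+-*-commutativeRing isZero
  where
  isZero : ∀ q → Maybe (0ℚ ≡ q)
  isZero q with 0ℚ ℚP.≟ q
  ... | yes 0≡q = just 0≡q
  ... | no _    = nothing

geo-horner : ∀ Δ j → Δ * geo Δ j + 1ℚ ≡ geo Δ (suc j)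
geo-horner Δ zero    = base Δ
  where
  base : ∀ Δ → Δ * 1ℚ + 1ℚ ≡ 1ℚ + 1ℚ * Δ
  base = solve-∀ ℚ-ring
geo-horner Δ (suc j) = begin
  Δ * (geo Δ j + pow Δ j * Δ) + 1ℚ   ≡⟨ regroup Δ (geo Δ j) (pow Δ j) ⟩
  (Δ * geo Δ j + 1ℚ) + pow Δ j * Δ * Δ ≡⟨ cong (_+ pow Δ j * Δ * Δ) (geo-horner Δ j) ⟩
  geo Δ (suc j) + pow Δ (suc j) * Δ  ∎
  where
  open ≡-Reasoning
  regroup : ∀ Δ g p → Δ * (g + p * Δ) + 1ℚ ≡ (Δ * g + 1ℚ) + p * Δ * Δ
  regroup = solve-∀ ℚ-ring

Δ*Dprev≤D : ∀ {W} Δ → 0ℚ ≤ W → ∀ i → Δ * Dprev W Δ i ≤ D W Δ i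
Δ*Dprev≤D {W} Δ 0≤W zero = begin
  Δ * 0ℚ ≡⟨ ℚP.*-zeroʳ Δ ⟩
  0ℚ     ≤⟨ 0≤W ⟩
  W      ≡⟨ ℚP.*-identityʳ W ⟨
  W * 1ℚ ∎
  where open ℚP.≤-Reasoning
Δ*Dprev≤D {W} Δ 0≤W (suc j) = begin
  Δ * (W * geo Δ j)      ≡⟨ swap-factors Δ W (geo Δ j) ⟩
  W * (Δ * geo Δ j)      ≤⟨ ℚP.*-monoˡ-≤-nonNeg W {{nonNegative 0≤W}} (p≤p+1 (Δ * geo Δ j)) ⟩
  W * (Δ * geo Δ j + 1ℚ) ≡⟨ cong (W *_) (geo-horner Δ j) ⟩
  W * geo Δ (suc j)      ∎
  where
  open ℚP.≤-Reasoning
  swap-factors : ∀ Δ W g → Δ * (W * g) ≡ W * (Δ * g)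
  swap-factors = solve-∀ ℚ-ring
  p≤p+1 : ∀ p → p ≤ p + 1ℚ
  p≤p+1 p = ℚP.≤-trans (ℚP.≤-reflexive (sym (ℚP.+-identityʳ p))) (ℚP.+-monoʳ-≤ p (ℚP.nonNegative⁻¹ 1ℚ))

module Constants (Δ : ℚ) (hΔ : ℚ[ 3 ] < Δ) where

  radius : ℚ → ℚ
  radius X = ((ℚ[ 2 ] * Δ) ÷[Δ-3] (Δ , hΔ)) * X

  stretch : ℚ
  stretch = ℚ[ 3 ] + (ℚ[ 8 ] ÷[Δ-3] (Δ , hΔ))

  private
    instance
      Δ-3-positive : Positive (Δ - ℚ[ 3 ])
      Δ-3-positive = positive (Δ-3>0 Δ hΔ)

    t : ℚ
    t = (1/ (Δ - ℚ[ 3 ])) {{ℚP.pos⇒nonZero (Δ - ℚ[ 3 ])}}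

    instance
      t-nonNeg : NonNegative t
      t-nonNeg = ℚP.pos⇒nonNeg t {{ℚP.1/pos⇒pos (Δ - ℚ[ 3 ])}}

    [Δ-3]*t≡1 : (Δ - ℚ[ 3 ]) * t ≡ 1ℚ
    [Δ-3]*t≡1 = ℚP.*-inverseʳ (Δ - ℚ[ 3 ]) {{ℚP.pos⇒nonZero (Δ - ℚ[ 3 ])}}

  detour-within-radius : ∀ {Dp Di d} → Δ * Dp ≤ Di → d ≤ Di →
                         radius Dp + ((radius Dp + d) + (radius Dp + d)) ≤ radius Di
  detour-within-radius {Dp} {Di} {d} ΔDp≤Di d≤Di = begin
    radius Dp + ((radius Dp + d) + (radius Dp + d))    ≡⟨ expand Δ t Dp d ⟩
    ℚ[ 6 ] * t * (Δ * Dp) + ℚ[ 2 ] * d                 ≤⟨ ℚP.+-mono-≤ (6t* ΔDp≤Di) (ℚP.*-monoˡ-≤-nonNeg ℚ[ 2 ] d≤Di) ⟩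
    ℚ[ 6 ] * t * Di + ℚ[ 2 ] * Di                      ≡⟨ cong (λ z → ℚ[ 6 ] * t * Di + ℚ[ 2 ] * z) (ℚP.*-identityˡ Di) ⟨
    ℚ[ 6 ] * t * Di + ℚ[ 2 ] * (1ℚ * Di)               ≡⟨ cong (λ z → ℚ[ 6 ] * t * Di + ℚ[ 2 ] * (z * Di)) [Δ-3]*t≡1 ⟨
    ℚ[ 6 ] * t * Di + ℚ[ 2 ] * ((Δ - ℚ[ 3 ]) * t * Di) ≡⟨ collect Δ t Di ⟨
    radius Di                                          ∎
    where
    open ℚP.≤-Reasoning
    expand : ∀ Δ t Dp d → let e = ℚ[ 2 ] * Δ * t * Dp in
             e + ((e + d) + (e + d)) ≡ ℚ[ 6 ] * t * (Δ * Dp) + ℚ[ 2 ] * d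
    expand = solve-∀ ℚ-ring
    collect : ∀ Δ t X → ℚ[ 2 ] * Δ * t * X ≡ ℚ[ 6 ] * t * X + ℚ[ 2 ] * ((Δ - ℚ[ 3 ]) * t * X)
    collect = solve-∀ ℚ-ring
    6t* : ∀ {p q} → p ≤ q → ℚ[ 6 ] * t * p ≤ ℚ[ 6 ] * t * q
    6t* = ℚP.*-monoˡ-≤-nonNeg (ℚ[ 6 ] * t) {{ℚP.nonNeg*nonNeg⇒nonNeg ℚ[ 6 ] t}}

  detour-within-stretch : ∀ Dp d → radius Dp + ((radius Dp + d) + (radius Dp + d)) + (radius Dp + d)
                                   ≤ stretch * ((Δ * Dp) ⊔ d)
  detour-within-stretch Dp d = begin
    radius Dp + ((radius Dp + d) + (radius Dp + d)) + (radius Dp + d) ≡⟨ expand Δ t Dp d ⟩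
    ℚ[ 8 ] * t * (Δ * Dp) + ℚ[ 3 ] * d                 ≤⟨ ℚP.+-mono-≤ (8t* (ℚP.p≤p⊔q (Δ * Dp) d))
                                                                       (ℚP.*-monoˡ-≤-nonNeg ℚ[ 3 ] (ℚP.p≤q⊔p (Δ * Dp) d)) ⟩
    ℚ[ 8 ] * t * m + ℚ[ 3 ] * m                        ≡⟨ collect t m ⟩
    stretch * m                                        ∎
    where
    open ℚP.≤-Reasoning
    m : ℚ
    m = (Δ * Dp) ⊔ d
    expand : ∀ Δ t Dp d → let e = ℚ[ 2 ] * Δ * t * Dp in
             e + ((e + d) + (e + d)) + (e + d) ≡ ℚ[ 8 ] * t * (Δ * Dp) + ℚ[ 3 ] * d
    expand = solve-∀ ℚ-ring
    collect : ∀ t m → ℚ[ 8 ] * t * m + ℚ[ 3 ] * m ≡ (ℚ[ 3 ] + ℚ[ 8 ] * t) * m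
    collect = solve-∀ ℚ-ring
    8t* : ∀ {p q} → p ≤ q → ℚ[ 8 ] * t * p ≤ ℚ[ 8 ] * t * q
    8t* = ℚP.*-monoˡ-≤-nonNeg (ℚ[ 8 ] * t) {{ℚP.nonNeg*nonNeg⇒nonNeg ℚ[ 8 ] t}}

lemmaB1 : (n k : ℕ) → k ≥ 1 → (G : Graph n) →
    (A : ℕ → Subset n) → IsHierarchy k A →
    (dG : Fin n → Fin n → ℚ∞) → IsDistFn (GEdge G) dG →
    (piv : ℕ → Fin n → Maybe (Fin n)) → IsPivotFn A dG piv →
    (dH : Fin n → Fin n → ℚ∞) → IsDistFn (HEdge k A dG piv) dH →
    (Δ : ℚ) → (hΔ : ℚ[ 3 ] < Δ) →
    (i : ℕ) → i Data.Nat.≤ k → (x y : Fin n) →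
    (P : Walk (GEdge G) x y) → IsPath P → dG x y ≡ fin (len P) →
    len P ≤ D (maxW P) Δ i →
    (Σ (Fin n) λ p → (piv i x ≡ just p) ×
       (dH x p ≤∞ fin (((ℚ[ 2 ] * Δ) ÷[Δ-3] (Δ , hΔ)) * Dprev (maxW P) Δ i))) →
    (dH x y ≤∞ fin ((ℚ[ 3 ] + (ℚ[ 8 ] ÷[Δ-3] (Δ , hΔ)))
                     * ((Δ * Dprev (maxW P) Δ i) ⊔ len P)))
    ⊎ (Σ (Fin n) λ p → (piv (Data.Nat.suc i) x ≡ just p) ×
       (dH x p ≤∞ fin (((ℚ[ 2 ] * Δ) ÷[Δ-3] (Δ , hΔ)) * D (maxW P) Δ i)))
lemmaB1 n k _ G A hier dG isDG piv isP dH isDH Δ hΔ i _ x y P _ xy≡P P≤Dᵢ (u , x→u , xu≤e) =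
  [ inj₂ , inj₁ ∘ short-detour ]′ (pivot-near-or-ball-avoids (suc i) x (radius (D (maxW P) Δ i)))
  where
  open Emulator G A hier dG isDG piv isP dH isDH
  open Constants Δ hΔ
  short-detour : (∀ a → a ∈ A (suc i) → fin (radius (D (maxW P) Δ i)) <∞ dG x a) →
                 dH x y ≤∞ fin (stretch * ((Δ * Dprev (maxW P) Δ i) ⊔ len P))
  short-detour far = ≤∞-trans
    (detour-via-pivots x→u xu≤e (≤∞-reflexive xy≡P)
       (detour-within-radius (Δ*Dprev≤D Δ (maxW-nonNeg P) i) P≤Dᵢ) far)
    (detour-within-stretch (Dprev (maxW P) Δ i) (len P))
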